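{- Let $U_1$ and $U_2$ be two degree-similar unicyclic graphs. Then $U_1$ and $U_2$ have the same girth.
   Context: A graph is unicyclic if it is connected and contains exactly one cycle; the girth is the length of a shortest cycle. For a graph $G$, $A(G)$ is its adjacency matrix and $D(G)$ its diagonal degree matrix. Two graphs $G_1,G_2$ are degree-similar if there is an invertible real matrix $M$ with $M^{ -1}A(G_1)M=A(G_2)$ and $M^{ -1}D(G_1)M=D(G_2)$.
   Formalization: The invertible matrix $M$ in the definition of degree-similar graphs has rational entries rather than real ones. -}

module Defs where

open import Data.Nat using (ℕ; zero; suc; _≤_)
open import Data.Fin using (Fin; zero; suc; inject₁; fromℕ; _≟_)
open import Data.Bool using (Bool; true; false; if_then_else_)
open import Data.Rational using (ℚ; 0ℚ; 1ℚ; _+_; _*_)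
open import Data.Product using (Σ; ∃; _×_; _,_)
open import Data.Sum using (_⊎_)
open import Relation.Binary.PropositionalEquality using (_≡_)
open import Relation.Nullary using (yes; no)
open import Function.Definitions using (Injective)
open import Function.Bundles using (_⇔_)

record Graph (n : ℕ) : Set where
  field
    adj   : Fin n → Fin n → Bool
    sym   : ∀ u v → adj u v ≡ adj v u
    irrefl : ∀ u → adj u u ≡ false
open Graph public

Adj : ∀ {n} → Graph n → Fin n → Fin n → Set
Adj G u v = adj G u v ≡ true

data Walk {n} (G : Graph n) : Fin n → Fin n → Set where
  here : ∀ {u} → Walk G u u
  step : ∀ {u v w} → Adj G u v → Walk G v w → Walk G u w

Connected : ∀ {n} → Graph n → Set
Connected {n} G = ∀ (u v : Fin n) → Walk G u v

record Cycle {n} (G : Graph n) : Set where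
  field
    m       : ℕ
    long    : 2 ≤ m
    vtx     : Fin (suc m) → Fin n
    distinct : Injective _≡_ _≡_ vtx
    consec  : ∀ (i : Fin m) → Adj G (vtx (inject₁ i)) (vtx (suc i))
    close   : Adj G (vtx (fromℕ m)) (vtx zero)
open Cycle public

cycleLength : ∀ {n} {G : Graph n} → Cycle G → ℕ
cycleLength c = suc (m c)

CycleEdge : ∀ {n} {G : Graph n} → Cycle G → Fin n → Fin n → Set
CycleEdge c u v =
    (Σ (Fin (m c)) λ i →
       (vtx c (inject₁ i) ≡ u × vtx c (suc i) ≡ v)
     ⊎ (vtx c (inject₁ i) ≡ v × vtx c (suc i) ≡ u))
  ⊎ ((vtx c (fromℕ (m c)) ≡ u × vtx c zero ≡ v)
     ⊎ (vtx c (fromℕ (m c)) ≡ v × vtx c zero ≡ u))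

-- two cycles are the same cycle (subgraph) iff they have the same edge set
SameCycle : ∀ {n} {G : Graph n} → Cycle G → Cycle G → Set
SameCycle {n} c d = ∀ (u v : Fin n) → CycleEdge c u v ⇔ CycleEdge d u v

Unicyclic : ∀ {n} → Graph n → Set
Unicyclic G = Connected G × Σ (Cycle G) (λ c → ∀ (d : Cycle G) → SameCycle c d)

IsGirth : ∀ {n} → Graph n → ℕ → Set
IsGirth G g = Σ (Cycle G) (λ c → cycleLength c ≡ g) × (∀ (d : Cycle G) → g ≤ cycleLength d)

Matrix : ℕ → Set
Matrix n = Fin n → Fin n → ℚ

Σ[_] : ∀ {n} → (Fin n → ℚ) → ℚ
Σ[_] {zero}  f = 0ℚ
Σ[_] {suc n} f = f zero + Σ[_] {n} (λ i → f (suc i))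

_⊗_ : ∀ {n} → Matrix n → Matrix n → Matrix n
(M ⊗ N) i j = Σ[ (λ k → M i k * N k j) ]

I : ∀ {n} → Matrix n
I i j with i ≟ j
... | yes _ = 1ℚ
... | no _  = 0ℚ

adjMatrix : ∀ {n} → Graph n → Matrix n
adjMatrix G u v = if adj G u v then 1ℚ else 0ℚ

degMatrix : ∀ {n} → Graph n → Matrix n
degMatrix G u v with u ≟ v
... | yes _ = Σ[ (λ w → adjMatrix G u w) ]
... | no _  = 0ℚ

DegreeSimilar : ∀ {n} → Graph n → Graph n → Set
DegreeSimilar {n} G₁ G₂ =
  Σ (Matrix n) λ M → Σ (Matrix n) λ N →
    (∀ i j → (M ⊗ N) i j ≡ I i j) ×
    (∀ i j → (N ⊗ M) i j ≡ I i j) ×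
    (∀ i j → (N ⊗ (adjMatrix G₁ ⊗ M)) i j ≡ adjMatrix G₂ i j) ×
    (∀ i j → (N ⊗ (degMatrix G₁ ⊗ M)) i j ≡ degMatrix G₂ i j)

{-# OPTIONS --safe #-}
module Submission where

-- The girth is determined by the numbers of closed non-backtracking walks:
-- a cycle of length ℓ is such a walk, and such a walk of length L contains a
-- cycle of length at most L. If P k counts the non-backtracking walks of length
-- k + 1, then P 0 = A, P 1 = A² − D and P (k + 2) = A P (k + 1) − (D − I) P k,
-- so a matrix N with N A = A′ N and N D = D′ N also satisfies N P k = P′ k N.
-- Since N is invertible, P k and P′ k have the same trace, i.e. the two graphs
-- have equally many closed non-backtracking walks of every length.

open import Defs
open import Algebra.Bundles using (Ring; CommutativeRing)
open import Data.Bool using (true; false; if_then_else_)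
open import Data.Empty using (⊥-elim)
open import Data.Fin using (Fin; zero; suc; toℕ; inject₁; fromℕ; fromℕ<; _≟_; punchIn)
  renaming (_<_ to _<ꟳ_)
open import Data.Fin.Properties
  using (toℕ-injective; toℕ<n; toℕ-fromℕ<; toℕ-fromℕ; toℕ-inject₁; punchInᵢ≢i; any?; <-cmp)
  renaming (_<?_ to _<ꟳ?_)
open import Data.Maybe using (Maybe; just; nothing)
open import Data.Nat as ℕ using (ℕ; zero; suc; _∸_; _≤_; _<_; z≤n; s≤s; z<s)
open import Data.Nat.DivMod using (_mod_; m<n⇒m%n≡m; n%n≡0)
open import Data.Nat.Induction using (<-rec)
open import Data.Nat.Properties
  using (≤-refl; ≤-trans; <-trans; ≤-<-trans; <-≤-trans; <⇒≤; <⇒≢; ≤-antisym; n≮0; n<1+n; n≤1+n;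
         m≤m+n; m≤n+m; m≢1+n+m; suc-injective; m∸n≤m; m∸n+n≡m; m≤o∸n⇒m+n≤o; m<n⇒0<n∸m;
         m<1+n⇒m<n∨m≡n; m≤n⇒m<n∨m≡n; +-0-monoid)
open import Data.Product using (∃; ∃₂; _×_; _,_)
open import Data.Rational as ℚ using (ℚ; 0ℚ; 1ℚ; _+_; _*_; _-_; -_)
open import Data.Rational.Properties as ℚₚ
  using (+-*-ring; +-0-group; +-identityʳ; *-identityˡ; *-identityʳ; *-zeroˡ; *-zeroʳ; *-assoc; *-comm)
open import Data.Sum using (inj₁; inj₂)
open import Data.Unit using (⊤; tt)
open import Function using (_∘_)
open import Function.Definitions using (Injective)
open import Level using (0ℓ)
open import Relation.Binary using (Rel; Setoid; tri<; tri≈; tri>)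
open import Relation.Binary.PropositionalEquality as ≡
  using (_≡_; _≢_; _≗_; refl; trans; cong; cong₂; subst; subst₂; module ≡-Reasoning)
open import Relation.Nullary using (Dec; yes; no; does; ¬_; ¬?; _×-dec_; contradiction)
open import Relation.Nullary.Decidable using (dec-true)

import Algebra.Properties.CommutativeSemigroup
  (CommutativeRing.*-commutativeSemigroup ℚₚ.+-*-commutativeRing) as ℚ-*
import Algebra.Properties.Group +-0-group as ℚ-group
import Algebra.Properties.Monoid.Sum +-0-monoid as ℕΣ
import Algebra.Properties.Ring +-*-ring as ℚ-ring
import Algebra.Properties.Semiring.Mult (Ring.semiring +-*-ring) as ℚ×
import Algebra.Properties.Semiring.Sum (Ring.semiring +-*-ring) as ℚΣ
import Relation.Binary.Reasoning.Setoid as SetoidReasoning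

private
  variable
    n : ℕ

Σ≡sum : (f : Fin n → ℚ) → Σ[ f ] ≡ ℚΣ.sum f
Σ≡sum {zero}  f = refl
Σ≡sum {suc n} f = cong (f zero +_) (Σ≡sum (f ∘ suc))

Σ-cong : {f g : Fin n → ℚ} → f ≗ g → Σ[ f ] ≡ Σ[ g ]
Σ-cong {f = f} {g} f≗g = begin
  Σ[ f ]     ≡⟨ Σ≡sum f ⟩
  ℚΣ.sum f   ≡⟨ ℚΣ.sum-cong-≗ f≗g ⟩
  ℚΣ.sum g   ≡⟨ Σ≡sum g ⟨
  Σ[ g ]     ∎
  where open ≡-Reasoning

Σ-distrib-+ : (f g : Fin n → ℚ) → Σ[ (λ i → f i + g i) ] ≡ Σ[ f ] + Σ[ g ]
Σ-distrib-+ f g = begin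
  Σ[ (λ i → f i + g i) ]       ≡⟨ Σ≡sum (λ i → f i + g i) ⟩
  ℚΣ.sum (λ i → f i + g i)     ≡⟨ ℚΣ.∑-distrib-+ f g ⟩
  ℚΣ.sum f + ℚΣ.sum g          ≡⟨ cong₂ _+_ (Σ≡sum f) (Σ≡sum g) ⟨
  Σ[ f ] + Σ[ g ]              ∎
  where open ≡-Reasoning

*-distribˡ-Σ : ∀ x (f : Fin n → ℚ) → x * Σ[ f ] ≡ Σ[ (λ i → x * f i) ]
*-distribˡ-Σ x f = begin
  x * Σ[ f ]                   ≡⟨ cong (x *_) (Σ≡sum f) ⟩
  x * ℚΣ.sum f                 ≡⟨ ℚΣ.*-distribˡ-sum x f ⟩
  ℚΣ.sum (λ i → x * f i)       ≡⟨ Σ≡sum (λ i → x * f i) ⟨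
  Σ[ (λ i → x * f i) ]         ∎
  where open ≡-Reasoning

*-distribʳ-Σ : ∀ x (f : Fin n → ℚ) → Σ[ f ] * x ≡ Σ[ (λ i → f i * x) ]
*-distribʳ-Σ x f = begin
  Σ[ f ] * x                   ≡⟨ cong (_* x) (Σ≡sum f) ⟩
  ℚΣ.sum f * x                 ≡⟨ ℚΣ.*-distribʳ-sum x f ⟩
  ℚΣ.sum (λ i → f i * x)       ≡⟨ Σ≡sum (λ i → f i * x) ⟨
  Σ[ (λ i → f i * x) ]         ∎
  where open ≡-Reasoning

Σ-comm : ∀ {m} (f : Fin m → Fin n → ℚ) →
         Σ[ (λ i → Σ[ f i ]) ] ≡ Σ[ (λ j → Σ[ (λ i → f i j) ]) ]
Σ-comm f = begin
  Σ[ (λ i → Σ[ f i ]) ]                   ≡⟨ Σ≡sum (λ i → Σ[ f i ]) ⟩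
  ℚΣ.sum (λ i → Σ[ f i ])                 ≡⟨ ℚΣ.sum-cong-≗ (λ i → Σ≡sum (f i)) ⟩
  ℚΣ.sum (λ i → ℚΣ.sum (f i))             ≡⟨ ℚΣ.∑-comm f ⟩
  ℚΣ.sum (λ j → ℚΣ.sum (λ i → f i j))     ≡⟨ ℚΣ.sum-cong-≗ (λ j → Σ≡sum (λ i → f i j)) ⟨
  ℚΣ.sum (λ j → Σ[ (λ i → f i j) ])       ≡⟨ Σ≡sum (λ j → Σ[ (λ i → f i j) ]) ⟨
  Σ[ (λ j → Σ[ (λ i → f i j) ]) ]         ∎
  where open ≡-Reasoning

Σ-neg : (f : Fin n → ℚ) → Σ[ (λ i → - f i) ] ≡ - Σ[ f ]
Σ-neg f = begin
  Σ[ (λ i → - f i) ]         ≡⟨ Σ-cong (λ i → ℚ-ring.-1*x≈-x (f i)) ⟨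
  Σ[ (λ i → - 1ℚ * f i) ]    ≡⟨ *-distribˡ-Σ (- 1ℚ) f ⟨
  - 1ℚ * Σ[ f ]              ≡⟨ ℚ-ring.-1*x≈-x _ ⟩
  - Σ[ f ]                   ∎
  where open ≡-Reasoning

Σ-distrib-− : (f g : Fin n → ℚ) → Σ[ (λ i → f i - g i) ] ≡ Σ[ f ] - Σ[ g ]
Σ-distrib-− f g = trans (Σ-distrib-+ f (λ i → - g i)) (cong (Σ[ f ] +_) (Σ-neg g))

Σ-supported : (f : Fin n → ℚ) (i : Fin n) → (∀ j → j ≢ i → f j ≡ 0ℚ) → Σ[ f ] ≡ f i
Σ-supported {suc n} f i f≡0 = begin
  Σ[ f ]
    ≡⟨ Σ≡sum f ⟩
  ℚΣ.sum f
    ≡⟨ ℚΣ.sum-remove f ⟩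
  f i + ℚΣ.sum (λ j → f (punchIn i j))
    ≡⟨ cong (f i +_) (ℚΣ.sum-cong-≗ (λ j → f≡0 _ (punchInᵢ≢i i j))) ⟩
  f i + ℚΣ.sum {n} (λ _ → 0ℚ)
    ≡⟨ cong (f i +_) (ℚΣ.sum-replicate-zero n) ⟩
  f i + 0ℚ
    ≡⟨ +-identityʳ (f i) ⟩
  f i
    ∎
  where open ≡-Reasoning

Σ-absorb : (e f x y : Fin n → ℚ) → (∀ i → e i * f i ≡ e i) →
           Σ[ (λ i → e i * (x i - f i * y i)) ] ≡ Σ[ (λ i → e i * x i) ] - Σ[ (λ i → e i * y i) ]
Σ-absorb e f x y ef≡e = trans (Σ-cong absorb) (Σ-distrib-− (λ i → e i * x i) (λ i → e i * y i))
  where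
  open ≡-Reasoning
  absorb : ∀ i → e i * (x i - f i * y i) ≡ e i * x i - e i * y i
  absorb i = begin
    e i * (x i - f i * y i)        ≡⟨ ℚ-ring.x[y-z]≈xy-xz (e i) (x i) (f i * y i) ⟩
    e i * x i - e i * (f i * y i)  ≡⟨ cong (λ z → e i * x i - z) (*-assoc (e i) (f i) (y i)) ⟨
    e i * x i - e i * f i * y i    ≡⟨ cong (λ z → e i * x i - z * y i) (ef≡e i) ⟩
    e i * x i - e i * y i          ∎

I-diagonal : (i : Fin n) → I i i ≡ 1ℚ
I-diagonal i with i ≟ i
... | yes _  = refl
... | no i≢i = contradiction refl i≢i

I-offDiagonal : {i j : Fin n} → i ≢ j → I i j ≡ 0ℚ
I-offDiagonal {i = i} {j} i≢j with i ≟ j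
... | yes i≡j = contradiction i≡j i≢j
... | no _    = refl

Σ-δ : (i : Fin n) (f : Fin n → ℚ) → Σ[ (λ k → I i k * f k) ] ≡ f i
Σ-δ i f = begin
  Σ[ (λ k → I i k * f k) ]  ≡⟨ Σ-supported (λ k → I i k * f k) i off-i ⟩
  I i i * f i               ≡⟨ cong (_* f i) (I-diagonal i) ⟩
  1ℚ * f i                  ≡⟨ *-identityˡ (f i) ⟩
  f i                       ∎
  where
  open ≡-Reasoning
  off-i : ∀ k → k ≢ i → I i k * f k ≡ 0ℚ
  off-i k k≢i = trans (cong (_* f k) (I-offDiagonal (k≢i ∘ ≡.sym))) (*-zeroˡ (f k))

infix  4 _≋_
infixl 6 _⊖_

_≋_ : Rel (Matrix n) 0ℓ
X ≋ Y = ∀ i j → X i j ≡ Y i j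

≋-refl : {X : Matrix n} → X ≋ X
≋-refl _ _ = refl

≋-sym : {X Y : Matrix n} → X ≋ Y → Y ≋ X
≋-sym X≋Y i j = ≡.sym (X≋Y i j)

≋-setoid : ℕ → Setoid 0ℓ 0ℓ
≋-setoid n = record
  { Carrier       = Matrix n
  ; _≈_           = _≋_
  ; isEquivalence = record
    { refl  = ≋-refl
    ; sym   = ≋-sym
    ; trans = λ X≋Y Y≋Z i j → trans (X≋Y i j) (Y≋Z i j)
    }
  }

module ≋-Reasoning {n} = SetoidReasoning (≋-setoid n)

_⊖_ : Matrix n → Matrix n → Matrix n
(X ⊖ Y) i j = X i j - Y i j

private
  variable
    M N X X′ Y Y′ : Matrix n

⊗-congˡ : (Z : Matrix n) → X ≋ X′ → Z ⊗ X ≋ Z ⊗ X′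
⊗-congˡ Z X≋X′ i j = Σ-cong (λ k → cong (Z i k *_) (X≋X′ k j))

⊗-congʳ : (Z : Matrix n) → X ≋ X′ → X ⊗ Z ≋ X′ ⊗ Z
⊗-congʳ Z X≋X′ i j = Σ-cong (λ k → cong (_* Z k j) (X≋X′ i k))

⊖-cong : X ≋ X′ → Y ≋ Y′ → X ⊖ Y ≋ X′ ⊖ Y′
⊖-cong X≋X′ Y≋Y′ i j = cong₂ _-_ (X≋X′ i j) (Y≋Y′ i j)

⊗-assoc : (X Y Z : Matrix n) → (X ⊗ Y) ⊗ Z ≋ X ⊗ (Y ⊗ Z)
⊗-assoc X Y Z i j = begin
  Σ[ (λ k → Σ[ (λ l → X i l * Y l k) ] * Z k j) ]
    ≡⟨ Σ-cong (λ k → *-distribʳ-Σ (Z k j) (λ l → X i l * Y l k)) ⟩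
  Σ[ (λ k → Σ[ (λ l → X i l * Y l k * Z k j) ]) ]
    ≡⟨ Σ-comm (λ k l → X i l * Y l k * Z k j) ⟩
  Σ[ (λ l → Σ[ (λ k → X i l * Y l k * Z k j) ]) ]
    ≡⟨ Σ-cong (λ l → Σ-cong (λ k → *-assoc (X i l) (Y l k) (Z k j))) ⟩
  Σ[ (λ l → Σ[ (λ k → X i l * (Y l k * Z k j)) ]) ]
    ≡⟨ Σ-cong (λ l → *-distribˡ-Σ (X i l) (λ k → Y l k * Z k j)) ⟨
  Σ[ (λ l → X i l * Σ[ (λ k → Y l k * Z k j) ]) ]
    ∎
  where open ≡-Reasoning

⊗-identityʳ : (X : Matrix n) → X ⊗ I ≋ X
⊗-identityʳ X i j = begin
  Σ[ (λ k → X i k * I k j) ]  ≡⟨ Σ-supported (λ k → X i k * I k j) j off-j ⟩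
  X i j * I j j               ≡⟨ cong (X i j *_) (I-diagonal j) ⟩
  X i j * 1ℚ                  ≡⟨ *-identityʳ (X i j) ⟩
  X i j                       ∎
  where
  open ≡-Reasoning
  off-j : ∀ k → k ≢ j → X i k * I k j ≡ 0ℚ
  off-j k k≢j = trans (cong (X i k *_) (I-offDiagonal k≢j)) (*-zeroʳ (X i k))

⊗-distribˡ-⊖ : (X Y Z : Matrix n) → X ⊗ (Y ⊖ Z) ≋ X ⊗ Y ⊖ X ⊗ Z
⊗-distribˡ-⊖ X Y Z i j =
  trans (Σ-cong (λ k → ℚ-ring.x[y-z]≈xy-xz (X i k) (Y k j) (Z k j)))
        (Σ-distrib-− (λ k → X i k * Y k j) (λ k → X i k * Z k j))

⊗-distribʳ-⊖ : (X Y Z : Matrix n) → (Y ⊖ Z) ⊗ X ≋ Y ⊗ X ⊖ Z ⊗ X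
⊗-distribʳ-⊖ X Y Z i j =
  trans (Σ-cong (λ k → ℚ-ring.[y-z]x≈yx-zx (X k j) (Y i k) (Z i k)))
        (Σ-distrib-− (λ k → Y i k * X k j) (λ k → Z i k * X k j))

trace : Matrix n → ℚ
trace X = Σ[ (λ i → X i i) ]

trace-cong : X ≋ Y → trace X ≡ trace Y
trace-cong X≋Y = Σ-cong (λ i → X≋Y i i)

trace-⊗-comm : (X Y : Matrix n) → trace (X ⊗ Y) ≡ trace (Y ⊗ X)
trace-⊗-comm X Y =
  trans (Σ-comm (λ i k → X i k * Y k i)) (Σ-cong (λ k → Σ-cong (λ i → *-comm (X i k) (Y k i))))

record Intertwines (N X Y : Matrix n) : Set where
  constructor intertwines
  field
    commute : N ⊗ X ≋ Y ⊗ N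

intertwines-≋ : X′ ≋ X → Y′ ≋ Y → Intertwines N X Y → Intertwines N X′ Y′
intertwines-≋ {X′ = X′} {X} {Y′} {Y} {N} X′≋X Y′≋Y (intertwines NX≋YN) =
  intertwines (begin
    N ⊗ X′   ≈⟨ ⊗-congˡ N X′≋X ⟩
    N ⊗ X    ≈⟨ NX≋YN ⟩
    Y ⊗ N    ≈⟨ ⊗-congʳ N Y′≋Y ⟨
    Y′ ⊗ N   ∎)
  where open ≋-Reasoning

intertwines-⊗ : Intertwines N X Y → Intertwines N X′ Y′ → Intertwines N (X ⊗ X′) (Y ⊗ Y′)
intertwines-⊗ {N = N} {X} {Y} {X′} {Y′} (intertwines NX≋YN) (intertwines NX′≋Y′N) =
  intertwines (begin
    N ⊗ (X ⊗ X′)   ≈⟨ ⊗-assoc N X X′ ⟨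
    (N ⊗ X) ⊗ X′   ≈⟨ ⊗-congʳ X′ NX≋YN ⟩
    (Y ⊗ N) ⊗ X′   ≈⟨ ⊗-assoc Y N X′ ⟩
    Y ⊗ (N ⊗ X′)   ≈⟨ ⊗-congˡ Y NX′≋Y′N ⟩
    Y ⊗ (Y′ ⊗ N)   ≈⟨ ⊗-assoc Y Y′ N ⟨
    (Y ⊗ Y′) ⊗ N   ∎)
  where open ≋-Reasoning

intertwines-⊖ : Intertwines N X Y → Intertwines N X′ Y′ → Intertwines N (X ⊖ X′) (Y ⊖ Y′)
intertwines-⊖ {N = N} {X} {Y} {X′} {Y′} (intertwines NX≋YN) (intertwines NX′≋Y′N) =
  intertwines (begin
    N ⊗ (X ⊖ X′)          ≈⟨ ⊗-distribˡ-⊖ N X X′ ⟩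
    N ⊗ X ⊖ N ⊗ X′        ≈⟨ ⊖-cong NX≋YN NX′≋Y′N ⟩
    Y ⊗ N ⊖ Y′ ⊗ N        ≈⟨ ⊗-distribʳ-⊖ N Y Y′ ⟨
    (Y ⊖ Y′) ⊗ N          ∎)
  where open ≋-Reasoning

conjugate⇒intertwines : M ⊗ N ≋ I → N ⊗ (X ⊗ M) ≋ Y → Intertwines N X Y
conjugate⇒intertwines {M = M} {N} {X} {Y} MN≋I NXM≋Y = intertwines (begin
  N ⊗ X                 ≈⟨ ⊗-congˡ N (⊗-identityʳ X) ⟨
  N ⊗ (X ⊗ I)           ≈⟨ ⊗-congˡ N (⊗-congˡ X MN≋I) ⟨
  N ⊗ (X ⊗ (M ⊗ N))     ≈⟨ ⊗-congˡ N (⊗-assoc X M N) ⟨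
  N ⊗ ((X ⊗ M) ⊗ N)     ≈⟨ ⊗-assoc N (X ⊗ M) N ⟨
  (N ⊗ (X ⊗ M)) ⊗ N     ≈⟨ ⊗-congʳ N NXM≋Y ⟩
  Y ⊗ N                 ∎)
  where open ≋-Reasoning

intertwines⇒trace≡ : M ⊗ N ≋ I → N ⊗ M ≋ I → Intertwines N X Y → trace X ≡ trace Y
intertwines⇒trace≡ {M = M} {N} {X} {Y} MN≋I NM≋I (intertwines NX≋YN) = begin
  trace X                 ≡⟨ trace-cong (⊗-identityʳ X) ⟨
  trace (X ⊗ I)           ≡⟨ trace-cong (⊗-congˡ X MN≋I) ⟨
  trace (X ⊗ (M ⊗ N))     ≡⟨ trace-cong (⊗-assoc X M N) ⟨
  trace ((X ⊗ M) ⊗ N)     ≡⟨ trace-⊗-comm (X ⊗ M) N ⟩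
  trace (N ⊗ (X ⊗ M))     ≡⟨ trace-cong (⊗-assoc N X M) ⟨
  trace ((N ⊗ X) ⊗ M)     ≡⟨ trace-cong (⊗-congʳ M NX≋YN) ⟩
  trace ((Y ⊗ N) ⊗ M)     ≡⟨ trace-cong (⊗-assoc Y N M) ⟩
  trace (Y ⊗ (N ⊗ M))     ≡⟨ trace-cong (⊗-congˡ Y NM≋I) ⟩
  trace (Y ⊗ I)           ≡⟨ trace-cong (⊗-identityʳ Y) ⟩
  trace Y                 ∎
  where open ≡-Reasoning

-- Counting non-backtracking walks

toℚ : ℕ → ℚ
toℚ k = k ℚ×.× 1ℚ

toℚ-sum : (f : Fin n → ℕ) → toℚ (ℕΣ.sum f) ≡ Σ[ toℚ ∘ f ]
toℚ-sum {zero}  f = refl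
toℚ-sum {suc n} f =
  trans (ℚ×.×-homo-+ 1ℚ (f zero) (ℕΣ.sum (f ∘ suc)))
        (cong (toℚ (f zero) +_) (toℚ-sum (f ∘ suc)))

toℚ-if : ∀ b k → toℚ (if b then k else 0) ≡ (if b then 1ℚ else 0ℚ) * toℚ k
toℚ-if true  k = ≡.sym (*-identityˡ (toℚ k))
toℚ-if false k = ≡.sym (*-zeroˡ (toℚ k))

0≤toℚ : ∀ k → 0ℚ ℚ.≤ toℚ k
0<toℚ-suc : ∀ k → 0ℚ ℚ.< toℚ (suc k)
0≤toℚ zero    = ℚₚ.≤-refl
0≤toℚ (suc k) = ℚₚ.<⇒≤ (0<toℚ-suc k)
0<toℚ-suc k   = ℚₚ.+-mono-<-≤ (ℚₚ.positive⁻¹ 1ℚ) (0≤toℚ k)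

toℚ-injective : ∀ {a b} → toℚ a ≡ toℚ b → a ≡ b
toℚ-injective {zero}  {zero}  _ = refl
toℚ-injective {zero}  {suc b} e = contradiction e (ℚₚ.<⇒≢ (0<toℚ-suc b))
toℚ-injective {suc a} {zero}  e = contradiction (≡.sym e) (ℚₚ.<⇒≢ (0<toℚ-suc a))
toℚ-injective {suc a} {suc b} e = cong suc (toℚ-injective (ℚ-group.∙-cancelˡ 1ℚ (toℚ a) (toℚ b) e))

≤-sum : (f : Fin n → ℕ) (i : Fin n) → f i ≤ ℕΣ.sum f
≤-sum f zero    = m≤m+n (f zero) _
≤-sum f (suc i) = ≤-trans (≤-sum (f ∘ suc) i) (m≤n+m _ (f zero))

sum-positive : (f : Fin n → ℕ) → 0 < ℕΣ.sum f → ∃ λ i → 0 < f i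
sum-positive {suc n} f pos with f zero in f₀≡
... | suc _ = zero , subst (0 <_) (≡.sym f₀≡) z<s
... | zero  = let i , fi>0 = sum-positive (f ∘ suc) pos in suc i , fi>0

if-positive : ∀ {b k} → b ≡ true → 0 < k → 0 < (if b then k else 0)
if-positive refl k>0 = k>0

dec-true⁻¹ : {A : Set} (a? : Dec A) → does a? ≡ true → A
dec-true⁻¹ (yes a) _ = a

if-positive⁻¹ : ∀ b {k} → 0 < (if b then k else 0) → b ≡ true × 0 < k
if-positive⁻¹ true k>0 = refl , k>0

Avoids : Maybe (Fin n) → Fin n → Set
Avoids nothing  w = ⊤
Avoids (just p) w = p ≢ w

avoids? : (p : Maybe (Fin n)) (w : Fin n) → Dec (Avoids p w)
avoids? nothing  w = yes tt
avoids? (just p) w = ¬? (p ≟ w)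

module _ (G : Graph n) where

  private
    A D : Matrix n
    A = adjMatrix G
    D = degMatrix G

  -- nbWalks k p u v counts the non-backtracking walks of length k from u to v
  -- that continue a walk which arrived at u from p.
  nbWalks : ℕ → Maybe (Fin n) → Fin n → Fin n → ℕ
  nbWalks zero    p u v = if does (u ≟ v) then 1 else 0
  nbWalks (suc k) p u v = ℕΣ.sum λ w →
    if adj G u w then (if does (avoids? p w) then nbWalks k (just u) w v else 0) else 0

  closedNBWalks : ℕ → ℕ
  closedNBWalks k = ℕΣ.sum λ u → nbWalks k nothing u u

  nbWalkMatrix : ℕ → Matrix n
  nbWalkMatrix k u v = toℚ (nbWalks (suc k) nothing u v)

  -- Walks u → w → u → … → v of length k + 2 that backtrack only at the first step.
  backtrackMatrix : ℕ → Matrix n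
  backtrackMatrix k u v = Σ[ (λ w → A u w * toℚ (nbWalks k (just w) u v)) ]

  trace-nbWalkMatrix : ∀ k → trace (nbWalkMatrix k) ≡ toℚ (closedNBWalks (suc k))
  trace-nbWalkMatrix k = ≡.sym (toℚ-sum (λ u → nbWalks (suc k) nothing u u))

  adj-idempotent : ∀ u w → A u w * A u w ≡ A u w
  adj-idempotent u w with adj G u w
  ... | true  = refl
  ... | false = refl

  adj-absorbs-sym : ∀ u w → A u w * A w u ≡ A u w
  adj-absorbs-sym u w =
    trans (cong (λ b → A u w * (if b then 1ℚ else 0ℚ)) (Graph.sym G w u)) (adj-idempotent u w)

  degree : Fin n → ℚ
  degree u = Σ[ A u ]

  degMatrix-δ : ∀ u v → D u v ≡ I u v * degree u
  degMatrix-δ u v with u ≟ v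
  ... | yes _ = ≡.sym (*-identityˡ (degree u))
  ... | no _  = ≡.sym (*-zeroˡ (degree u))

  degMatrix-⊗ : (X : Matrix n) → ∀ u v → (D ⊗ X) u v ≡ degree u * X u v
  degMatrix-⊗ X u v = begin
    Σ[ (λ w → D u w * X w v) ]                ≡⟨ Σ-cong (λ w → cong (_* X w v) (degMatrix-δ u w)) ⟩
    Σ[ (λ w → I u w * degree u * X w v) ]     ≡⟨ Σ-cong (λ w → *-assoc (I u w) (degree u) (X w v)) ⟩
    Σ[ (λ w → I u w * (degree u * X w v)) ]   ≡⟨ Σ-δ u (λ w → degree u * X w v) ⟩
    degree u * X u v                          ∎
    where open ≡-Reasoning

  toℚ-nbWalks-zero : ∀ p u v → toℚ (nbWalks zero p u v) ≡ I u v
  toℚ-nbWalks-zero p u v with u ≟ v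
  ... | yes _ = refl
  ... | no _  = refl

  toℚ-avoiding : ∀ (q w : Fin n) k →
    toℚ (if does (avoids? (just q) w) then k else 0) ≡ toℚ k - I q w * toℚ k
  toℚ-avoiding q w k with q ≟ w
  ... | yes _ = ≡.sym (trans (cong (_-_ (toℚ k)) (*-identityˡ (toℚ k))) (ℚₚ.+-inverseʳ (toℚ k)))
  ... | no _  = ≡.sym (trans (cong (_-_ (toℚ k)) (*-zeroˡ (toℚ k))) (+-identityʳ (toℚ k)))

  nbWalkMatrix-unfold : ∀ k u v →
    nbWalkMatrix k u v ≡ Σ[ (λ w → A u w * toℚ (nbWalks k (just u) w v)) ]
  nbWalkMatrix-unfold k u v =
    trans (toℚ-sum (λ w → if adj G u w then nbWalks k (just u) w v else 0))
          (Σ-cong (λ w → toℚ-if (adj G u w) (nbWalks k (just u) w v)))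

  toℚ-nbWalks-avoiding : ∀ k q u v →
    toℚ (nbWalks (suc k) (just q) u v) ≡ nbWalkMatrix k u v - A u q * toℚ (nbWalks k (just u) q v)
  toℚ-nbWalks-avoiding k q u v = begin
    toℚ (nbWalks (suc k) (just q) u v)
      ≡⟨ toℚ-sum (λ w → if adj G u w then (if does (avoids? (just q) w) then c w else 0) else 0) ⟩
    Σ[ (λ w → toℚ (if adj G u w then (if does (avoids? (just q) w) then c w else 0) else 0)) ]
      ≡⟨ Σ-cong (λ w → toℚ-if (adj G u w) (if does (avoids? (just q) w) then c w else 0)) ⟩
    Σ[ (λ w → A u w * toℚ (if does (avoids? (just q) w) then c w else 0)) ]
      ≡⟨ Σ-cong (λ w → cong (A u w *_) (toℚ-avoiding q w (c w))) ⟩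
    Σ[ (λ w → A u w * (toℚ (c w) - I q w * toℚ (c w))) ]
      ≡⟨ Σ-cong (λ w → ℚ-ring.x[y-z]≈xy-xz (A u w) (toℚ (c w)) (I q w * toℚ (c w))) ⟩
    Σ[ (λ w → A u w * toℚ (c w) - A u w * (I q w * toℚ (c w))) ]
      ≡⟨ Σ-cong (λ w → cong (_-_ (A u w * toℚ (c w)))
                            (ℚ-*.x∙yz≈y∙xz (A u w) (I q w) (toℚ (c w)))) ⟩
    Σ[ (λ w → A u w * toℚ (c w) - I q w * (A u w * toℚ (c w))) ]
      ≡⟨ Σ-distrib-− (λ w → A u w * toℚ (c w)) (λ w → I q w * (A u w * toℚ (c w))) ⟩
    Σ[ (λ w → A u w * toℚ (c w)) ] - Σ[ (λ w → I q w * (A u w * toℚ (c w))) ]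
      ≡⟨ cong₂ _-_ (≡.sym (nbWalkMatrix-unfold k u v)) (Σ-δ q (λ w → A u w * toℚ (c w))) ⟩
    nbWalkMatrix k u v - A u q * toℚ (c q)
      ∎
    where
    open ≡-Reasoning
    c : Fin n → ℕ
    c w = nbWalks k (just u) w v

  nbWalkMatrix-zero : nbWalkMatrix 0 ≋ A
  nbWalkMatrix-zero u v = begin
    nbWalkMatrix 0 u v
      ≡⟨ nbWalkMatrix-unfold 0 u v ⟩
    Σ[ (λ w → A u w * toℚ (nbWalks 0 (just u) w v)) ]
      ≡⟨ Σ-cong (λ w → cong (A u w *_) (toℚ-nbWalks-zero (just u) w v)) ⟩
    (A ⊗ I) u v
      ≡⟨ ⊗-identityʳ A u v ⟩
    A u v
      ∎
    where open ≡-Reasoning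

  nbWalkMatrix-suc : ∀ k → nbWalkMatrix (suc k) ≋ A ⊗ nbWalkMatrix k ⊖ backtrackMatrix k
  nbWalkMatrix-suc k u v = begin
    nbWalkMatrix (suc k) u v
      ≡⟨ nbWalkMatrix-unfold (suc k) u v ⟩
    Σ[ (λ w → A u w * toℚ (nbWalks (suc k) (just u) w v)) ]
      ≡⟨ Σ-cong (λ w → cong (A u w *_) (toℚ-nbWalks-avoiding k u w v)) ⟩
    Σ[ (λ w → A u w * (nbWalkMatrix k w v - A w u * toℚ (nbWalks k (just w) u v))) ]
      ≡⟨ Σ-absorb (A u) (λ w → A w u) (λ w → nbWalkMatrix k w v)
                  (λ w → toℚ (nbWalks k (just w) u v)) (adj-absorbs-sym u) ⟩
    (A ⊗ nbWalkMatrix k) u v - backtrackMatrix k u v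
      ∎
    where open ≡-Reasoning

  backtrackMatrix-zero : backtrackMatrix 0 ≋ D
  backtrackMatrix-zero u v = begin
    Σ[ (λ w → A u w * toℚ (nbWalks 0 (just w) u v)) ]
      ≡⟨ Σ-cong (λ w → cong (A u w *_) (toℚ-nbWalks-zero (just w) u v)) ⟩
    Σ[ (λ w → A u w * I u v) ]
      ≡⟨ *-distribʳ-Σ (I u v) (A u) ⟨
    degree u * I u v
      ≡⟨ *-comm (degree u) (I u v) ⟩
    I u v * degree u
      ≡⟨ degMatrix-δ u v ⟨
    D u v
      ∎
    where open ≡-Reasoning

  backtrackMatrix-suc : ∀ k → backtrackMatrix (suc k) ≋ D ⊗ nbWalkMatrix k ⊖ nbWalkMatrix k
  backtrackMatrix-suc k u v = begin
    Σ[ (λ w → A u w * toℚ (nbWalks (suc k) (just w) u v)) ]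
      ≡⟨ Σ-cong (λ w → cong (A u w *_) (toℚ-nbWalks-avoiding k w u v)) ⟩
    Σ[ (λ w → A u w * (nbWalkMatrix k u v - A u w * toℚ (nbWalks k (just u) w v))) ]
      ≡⟨ Σ-absorb (A u) (A u) (λ _ → nbWalkMatrix k u v)
                  (λ w → toℚ (nbWalks k (just u) w v)) (adj-idempotent u) ⟩
    Σ[ (λ w → A u w * nbWalkMatrix k u v) ] - Σ[ (λ w → A u w * toℚ (nbWalks k (just u) w v)) ]
      ≡⟨ cong₂ _-_ (*-distribʳ-Σ (nbWalkMatrix k u v) (A u)) (nbWalkMatrix-unfold k u v) ⟨
    degree u * nbWalkMatrix k u v - nbWalkMatrix k u v
      ≡⟨ cong (_- nbWalkMatrix k u v) (degMatrix-⊗ (nbWalkMatrix k) u v) ⟨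
    (D ⊗ nbWalkMatrix k) u v - nbWalkMatrix k u v
      ∎
    where open ≡-Reasoning

module _ (G₁ G₂ : Graph n) {N : Matrix n}
         (NA≋A′N : Intertwines N (adjMatrix G₁) (adjMatrix G₂))
         (ND≋D′N : Intertwines N (degMatrix G₁) (degMatrix G₂)) where

  nbWalkMatrix-intertwines : ∀ k → Intertwines N (nbWalkMatrix G₁ k) (nbWalkMatrix G₂ k)
  backtrackMatrix-intertwines : ∀ k → Intertwines N (backtrackMatrix G₁ k) (backtrackMatrix G₂ k)

  nbWalkMatrix-intertwines zero =
    intertwines-≋ (nbWalkMatrix-zero G₁) (nbWalkMatrix-zero G₂) NA≋A′N
  nbWalkMatrix-intertwines (suc k) =
    intertwines-≋ (nbWalkMatrix-suc G₁ k) (nbWalkMatrix-suc G₂ k)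
      (intertwines-⊖ (intertwines-⊗ NA≋A′N (nbWalkMatrix-intertwines k)) (backtrackMatrix-intertwines k))

  backtrackMatrix-intertwines zero =
    intertwines-≋ (backtrackMatrix-zero G₁) (backtrackMatrix-zero G₂) ND≋D′N
  backtrackMatrix-intertwines (suc k) =
    intertwines-≋ (backtrackMatrix-suc G₁ k) (backtrackMatrix-suc G₂ k)
      (intertwines-⊖ (intertwines-⊗ ND≋D′N (nbWalkMatrix-intertwines k)) (nbWalkMatrix-intertwines k))

degreeSimilar⇒closedNBWalks≡ : {G₁ G₂ : Graph n} → DegreeSimilar G₁ G₂ →
                               ∀ k → closedNBWalks G₁ (suc k) ≡ closedNBWalks G₂ (suc k)
degreeSimilar⇒closedNBWalks≡ {G₁ = G₁} {G₂} (M , N , MN≋I , NM≋I , NAM≋A′ , NDM≋D′) k =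
  toℚ-injective (begin
    toℚ (closedNBWalks G₁ (suc k))
      ≡⟨ trace-nbWalkMatrix G₁ k ⟨
    trace (nbWalkMatrix G₁ k)
      ≡⟨ intertwines⇒trace≡ MN≋I NM≋I (nbWalkMatrix-intertwines G₁ G₂ NA≋A′N ND≋D′N k) ⟩
    trace (nbWalkMatrix G₂ k)
      ≡⟨ trace-nbWalkMatrix G₂ k ⟩
    toℚ (closedNBWalks G₂ (suc k))
      ∎)
  where
  open ≡-Reasoning
  NA≋A′N : Intertwines N (adjMatrix G₁) (adjMatrix G₂)
  NA≋A′N = conjugate⇒intertwines MN≋I NAM≋A′
  ND≋D′N : Intertwines N (degMatrix G₁) (degMatrix G₂)
  ND≋D′N = conjugate⇒intertwines MN≋I NDM≋D′

record NBWalk (G : Graph n) (k : ℕ) (p : Maybe (Fin n)) (u v : Fin n) : Set where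
  field
    vertex          : ℕ → Fin n
    starts          : vertex 0 ≡ u
    ends            : vertex k ≡ v
    adjacent        : ∀ i → i < k → Adj G (vertex i) (vertex (suc i))
    nonBacktracking : ∀ i → suc (suc i) ≤ k → vertex i ≢ vertex (suc (suc i))
    avoidsPrevious  : 0 < k → Avoids p (vertex 1)

open NBWalk

module _ {G : Graph n} where

  _◂_ : Fin n → (ℕ → Fin n) → ℕ → Fin n
  (u ◂ w) zero    = u
  (u ◂ w) (suc i) = w i

  nbWalk-cons : ∀ {k p u x v} → Adj G u x → Avoids p x →
                NBWalk G k (just u) x v → NBWalk G (suc k) p u v
  nbWalk-cons {u = u} u~x px w = record
    { vertex          = u ◂ vertex w
    ; starts          = refl
    ; ends            = ends w
    ; adjacent        = λ where
        zero    _         → subst (Adj G u) (≡.sym (starts w)) u~x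
        (suc i) (s≤s i<k) → adjacent w i i<k
    ; nonBacktracking = λ where
        zero    (s≤s 0<k)   → avoidsPrevious w 0<k
        (suc i) (s≤s 2+i≤k) → nonBacktracking w i 2+i≤k
    ; avoidsPrevious  = λ _ → subst (Avoids _) (≡.sym (starts w)) px
    }

  nbWalk-tail : ∀ {k p u v} (w : NBWalk G (suc k) p u v) → NBWalk G k (just u) (vertex w 1) v
  nbWalk-tail w = record
    { vertex          = vertex w ∘ suc
    ; starts          = refl
    ; ends            = ends w
    ; adjacent        = λ i i<k → adjacent w (suc i) (s≤s i<k)
    ; nonBacktracking = λ i 2+i≤k → nonBacktracking w (suc i) (s≤s 2+i≤k)
    ; avoidsPrevious  = λ 0<k u≡w₂ → nonBacktracking w 0 (s≤s 0<k) (trans (starts w) u≡w₂)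
    }

  nbWalks-positive : ∀ {k p u v} → NBWalk G k p u v → 0 < nbWalks G k p u v
  nbWalks-positive {zero} {u = u} {v} w with u ≟ v
  ... | yes _   = z<s
  ... | no u≢v  = contradiction (trans (≡.sym (starts w)) (ends w)) u≢v
  nbWalks-positive {suc k} {p} {u} w =
    <-≤-trans (if-positive u~x (if-positive (dec-true (avoids? p x) (avoidsPrevious w z<s))
                                            (nbWalks-positive (nbWalk-tail w))))
              (≤-sum _ x)
    where
    x = vertex w 1
    u~x : Adj G u x
    u~x = subst (λ y → Adj G y x) (starts w) (adjacent w 0 z<s)

  nbWalks-witness : ∀ {k p u v} → 0 < nbWalks G k p u v → NBWalk G k p u v
  nbWalks-witness {zero} {u = u} {v} pos with u ≟ v
  ... | no _    = ⊥-elim (n≮0 pos)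
  ... | yes u≡v = record
    { vertex          = λ _ → u
    ; starts          = refl
    ; ends            = u≡v
    ; adjacent        = λ _ ()
    ; nonBacktracking = λ _ ()
    ; avoidsPrevious  = λ ()
    }
  nbWalks-witness {suc k} {p} {u} pos
    with x , term>0 ← sum-positive _ pos
    with u~x , term′>0 ← if-positive⁻¹ (adj G u x) term>0
    with px , rest>0 ← if-positive⁻¹ (does (avoids? p x)) term′>0
    = nbWalk-cons u~x (dec-true⁻¹ (avoids? p x) px) (nbWalks-witness rest>0)

-- Cycles and girth

module _ {G : Graph n} (c : Cycle G) where

  private
    ℓ : ℕ
    ℓ = m c

  cycleVertex : ℕ → Fin n
  cycleVertex j = vtx c (j mod suc ℓ)

  private
    toℕ-mod : ∀ {j} → j < suc ℓ → toℕ (j mod suc ℓ) ≡ j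
    toℕ-mod j<1+ℓ = trans (toℕ-fromℕ< _) (m<n⇒m%n≡m j<1+ℓ)

  cycleVertex-toℕ : ∀ f {j} → toℕ f ≡ j → vtx c f ≡ cycleVertex j
  cycleVertex-toℕ f refl = cong (vtx c) (toℕ-injective (≡.sym (toℕ-mod (toℕ<n f))))

  cycleVertex-periodic : cycleVertex (suc ℓ) ≡ cycleVertex 0
  cycleVertex-periodic = cong (vtx c) (toℕ-injective (trans (toℕ-fromℕ< _) (n%n≡0 (suc ℓ))))

  cycleVertex-injective : ∀ {i j} → i < suc ℓ → j < suc ℓ → cycleVertex i ≡ cycleVertex j → i ≡ j
  cycleVertex-injective i<1+ℓ j<1+ℓ e =
    trans (≡.sym (toℕ-mod i<1+ℓ)) (trans (cong toℕ (distinct c e)) (toℕ-mod j<1+ℓ))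

  cycle⇒closedNBWalk : NBWalk G (cycleLength c) nothing (cycleVertex 0) (cycleVertex 0)
  cycle⇒closedNBWalk = record
    { vertex          = cycleVertex
    ; starts          = refl
    ; ends            = cycleVertex-periodic
    ; adjacent        = adjacent′
    ; nonBacktracking = nonBacktracking′
    ; avoidsPrevious  = λ _ → tt
    }
    where
    adjacent′ : ∀ i → i < suc ℓ → Adj G (cycleVertex i) (cycleVertex (suc i))
    adjacent′ i i<1+ℓ with m<1+n⇒m<n∨m≡n i<1+ℓ
    ... | inj₁ i<ℓ  = subst₂ (Adj G)
                        (cycleVertex-toℕ (inject₁ f) (trans (toℕ-inject₁ f) (toℕ-fromℕ< i<ℓ)))
                        (cycleVertex-toℕ (suc f) (cong suc (toℕ-fromℕ< i<ℓ)))
                        (consec c f)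
      where f = fromℕ< i<ℓ
    ... | inj₂ refl = subst₂ (Adj G)
                        (cycleVertex-toℕ (fromℕ ℓ) (toℕ-fromℕ ℓ))
                        (trans (cycleVertex-toℕ zero refl) (≡.sym cycleVertex-periodic))
                        (close c)

    nonBacktracking′ : ∀ i → suc (suc i) ≤ suc ℓ → cycleVertex i ≢ cycleVertex (suc (suc i))
    nonBacktracking′ i 2+i≤1+ℓ e
      with m≤n⇒m<n∨m≡n 2+i≤1+ℓ | ≤-trans (n≤1+n (suc i)) 2+i≤1+ℓ
    ... | inj₁ 2+i<1+ℓ | i<1+ℓ = m≢1+n+m i (cycleVertex-injective i<1+ℓ 2+i<1+ℓ e)
    ... | inj₂ 2+i≡1+ℓ | i<1+ℓ =
      <⇒≢ (long c) (trans (cong suc (≡.sym i≡0)) (suc-injective 2+i≡1+ℓ))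
      where
      i≡0 : i ≡ 0
      i≡0 = cycleVertex-injective i<1+ℓ z<s
              (trans e (trans (cong cycleVertex 2+i≡1+ℓ) cycleVertex-periodic))

Collision : ∀ {L} → (Fin L → Fin n) → Set
Collision f = ∃₂ λ i j → i <ꟳ j × f i ≡ f j

collision? : ∀ {L} (f : Fin L → Fin n) → Dec (Collision f)
collision? f = any? λ i → any? λ j → (i <ꟳ? j) ×-dec (f i ≟ f j)

¬collision⇒injective : ∀ {L} {f : Fin L → Fin n} → ¬ Collision f → Injective _≡_ _≡_ f
¬collision⇒injective ¬collision {i} {j} fi≡fj with <-cmp i j
... | tri< i<j _ _ = contradiction (i , j , i<j , fi≡fj) ¬collision
... | tri≈ _ i≡j _ = i≡j
... | tri> _ _ j<i = contradiction (j , i , j<i , ≡.sym fi≡fj) ¬collision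

module _ {G : Graph n} where

  CycleWithin : ℕ → Set
  CycleWithin L = ∃ λ (c : Cycle G) → cycleLength c ≤ L

  ¬Adj-loop : ∀ u → ¬ Adj G u u
  ¬Adj-loop u u~u with () ← trans (≡.sym u~u) (irrefl G u)

  slice : ∀ {L p u v a b} (w : NBWalk G L p u v) → a ≤ b → b ≤ L →
          NBWalk G (b ∸ a) nothing (vertex w a) (vertex w b)
  slice {a = a} w a≤b b≤L = record
    { vertex          = λ i → vertex w (i ℕ.+ a)
    ; starts          = refl
    ; ends            = cong (vertex w) (m∸n+n≡m a≤b)
    ; adjacent        = λ i 1+i≤b∸a →
        adjacent w (i ℕ.+ a) (≤-trans (m≤o∸n⇒m+n≤o (suc i) a≤b 1+i≤b∸a) b≤L)
    ; nonBacktracking = λ i 2+i≤b∸a →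
        nonBacktracking w (i ℕ.+ a) (≤-trans (m≤o∸n⇒m+n≤o (suc (suc i)) a≤b 2+i≤b∸a) b≤L)
    ; avoidsPrevious  = λ _ → tt
    }

  injectiveClosedNBWalk⇒cycle : ∀ {ℓ p u} (w : NBWalk G (suc ℓ) p u u) → 2 ≤ ℓ →
                                Injective _≡_ _≡_ (vertex w ∘ toℕ) → Cycle G
  injectiveClosedNBWalk⇒cycle {ℓ} w 2≤ℓ injective = record
    { m        = ℓ
    ; long     = 2≤ℓ
    ; vtx      = vertex w ∘ toℕ
    ; distinct = injective
    ; consec   = λ i → subst (λ j → Adj G (vertex w j) (vertex w (suc (toℕ i))))
                             (≡.sym (toℕ-inject₁ i))
                             (adjacent w (toℕ i) (<-trans (toℕ<n i) (n<1+n ℓ)))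
    ; close    = subst₂ (Adj G) (cong (vertex w) (≡.sym (toℕ-fromℕ ℓ)))
                                (trans (ends w) (≡.sym (starts w)))
                                (adjacent w ℓ (n<1+n ℓ))
    }

  -- A closed non-backtracking walk without repeated vertices is a cycle;
  -- otherwise the part between two visits of a vertex is a shorter one.
  closedNBWalk⇒cycle : ∀ L {u} → 0 < L → NBWalk G L nothing u u → CycleWithin L
  closedNBWalk⇒cycle = <-rec _ shorten
    where
    shorten : ∀ L → (∀ {L′} → L′ < L → ∀ {u} → 0 < L′ → NBWalk G L′ nothing u u → CycleWithin L′) →
              ∀ {u} → 0 < L → NBWalk G L nothing u u → CycleWithin L
    shorten 1 _ {u} _ w =
      ⊥-elim (¬Adj-loop u (subst₂ (Adj G) (starts w) (ends w) (adjacent w 0 z<s)))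
    shorten 2 _ _ w =
      ⊥-elim (nonBacktracking w 0 ≤-refl (trans (starts w) (≡.sym (ends w))))
    shorten L@(suc ℓ@(suc (suc _))) rec _ w with collision? (vertex w ∘ toℕ {L})
    ... | no ¬collision =
      injectiveClosedNBWalk⇒cycle w (s≤s (s≤s z≤n)) (¬collision⇒injective ¬collision) , ≤-refl
    ... | yes (i , j , i<j , wi≡wj) =
      let c , c≤j∸i = rec j∸i<L (m<n⇒0<n∸m i<j)
                        (subst (NBWalk G _ nothing _) (≡.sym wi≡wj) (slice w (<⇒≤ i<j) (<⇒≤ (toℕ<n j))))
      in c , ≤-trans c≤j∸i (<⇒≤ j∸i<L)
      where
      j∸i<L : toℕ j ∸ toℕ i < L
      j∸i<L = ≤-<-trans (m∸n≤m (toℕ j) (toℕ i)) (toℕ<n j)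

  cycle⇒closedNBWalks-positive : (c : Cycle G) → 0 < closedNBWalks G (cycleLength c)
  cycle⇒closedNBWalks-positive c =
    <-≤-trans (nbWalks-positive (cycle⇒closedNBWalk c))
              (≤-sum (λ u → nbWalks G (cycleLength c) nothing u u) (cycleVertex c 0))

  closedNBWalks-positive⇒cycle : ∀ {L} → 0 < L → 0 < closedNBWalks G L → CycleWithin L
  closedNBWalks-positive⇒cycle {L} 0<L closed>0
    with u , u-closed>0 ← sum-positive (λ u → nbWalks G L nothing u u) closed>0 =
    closedNBWalk⇒cycle _ 0<L (nbWalks-witness u-closed>0)

sameClosedNBWalks⇒girth≤ : {G₁ G₂ : Graph n} →
                           (∀ k → closedNBWalks G₁ (suc k) ≡ closedNBWalks G₂ (suc k)) →
                           ∀ {g₁ g₂} → IsGirth G₁ g₁ → IsGirth G₂ g₂ → g₁ ≤ g₂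
sameClosedNBWalks⇒girth≤ same (_ , shortest₁) ((c₂ , refl) , _) =
  let d , d≤g₂ = closedNBWalks-positive⇒cycle z<s
                   (subst (0 <_) (≡.sym (same (m c₂))) (cycle⇒closedNBWalks-positive c₂))
  in ≤-trans (shortest₁ d) d≤g₂

mainTheorem6 : ∀ {n : ℕ} (U₁ U₂ : Graph n) → Unicyclic U₁ → Unicyclic U₂ →
    DegreeSimilar U₁ U₂ →
    ∀ (g₁ g₂ : ℕ) → IsGirth U₁ g₁ → IsGirth U₂ g₂ → g₁ ≡ g₂
mainTheorem6 U₁ U₂ _ _ similar g₁ g₂ girth₁ girth₂ =
  ≤-antisym (sameClosedNBWalks⇒girth≤ same girth₁ girth₂)
            (sameClosedNBWalks⇒girth≤ (≡.sym ∘ same) girth₂ girth₁)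
  where
  same = degreeSimilar⇒closedNBWalks≡ similar
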